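{- Let $n\geq 3$, $k\geq 6$, $f\geq (k-1)n$, and let the edges of the complete $k$-uniform hypergraph $\mathcal{H}=\mathcal{K}^k_f$ be colored red and blue. If $\mathcal{H}$ contains a red copy of $\mathcal{C}^k_n$ and contains no red copy of $\mathcal{C}^k_{n-1}$, then $\mathcal{H}$ contains a blue copy of $\mathcal{C}^k_n$.
   Context: A $k$-uniform loose cycle $\mathcal{C}^k_m$ is the hypergraph with vertex set $\{v_1,\dots,v_{m(k-1)}\}$ and the $m$ edges $e_i=\{v_{(i-1)(k-1)+1},\dots,v_{(i-1)(k-1)+k}\}$, $1\le i\le m$, indices taken modulo $m(k-1)$. A red (blue) copy is a copy all of whose edges are red (blue). -}

module Defs where

open import Data.Nat using (ℕ; _+_; _*_; _∸_; NonZero)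
open import Data.Nat.DivMod using (_mod_)
open import Data.Fin using (Fin; toℕ)
import Data.Fin as F
import Data.Nat as N
open import Data.Fin.Subset using (Subset; ⁅_⁆; _∪_; ∣_∣; ⊥)
open import Data.Bool using (Bool; true; false)
open import Data.Product using (Σ; _×_)
open import Function.Definitions using (Injective)
open import Relation.Binary.PropositionalEquality using (_≡_)

Colour : Set
Colour = Bool

red blue : Colour
red = true
blue = false

-- Edges are the k-element subsets of Fin f; the colouring
-- is a function on subsets, of which only the values on k-subsets matter.
Colouring : ℕ → Set
Colouring f = Subset f → Colour

⋃ : ∀ {f k} → (Fin k → Subset f) → Subset f
⋃ {k = N.zero}  G = ⊥
⋃ {k = N.suc k} G = G F.zero ∪ ⋃ (λ t → G (F.suc t))

-- The image under φ : Fin (m(k-1)) → Fin f of the i-th edge (0-indexed)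
-- e_{i+1} = {v_{i(k-1)+1}, …, v_{i(k-1)+k}} of the loose cycle C^k_m,
-- indices taken modulo m(k-1) (vertices are 0-indexed here: v_{j+1} ↦ j).
cycleEdge : ∀ {f} (k m : ℕ) .{{_ : NonZero (m * (k ∸ 1))}} →
            (Fin (m * (k ∸ 1)) → Fin f) → Fin m → Subset f
cycleEdge k m φ i = ⋃ (λ (t : Fin k) → ⁅ φ ((toℕ i * (k ∸ 1) + toℕ t) mod (m * (k ∸ 1))) ⁆)

HasMonoCycle : ∀ {f} (k m : ℕ) .{{_ : NonZero (m * (k ∸ 1))}} →
               Colouring f → Colour → Set
HasMonoCycle {f} k m χ c =
  Σ (Fin (m * (k ∸ 1)) → Fin f) λ φ →
    Injective _≡_ _≡_ φ × (∀ (i : Fin m) → χ (cycleEdge k m φ i) ≡ c)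

module Submission where

-- Write K = k − 1 and let v₀, …, v_{nK−1} (indices mod nK) be the red copy of C^k_n, whose edges
-- are the blocks {v_{iK}, …, v_{iK+K}}.  Fix β < K and δ ≤ K.  The vertices v_x for x ≤ (n−2)K,
-- with v₀ and v_β exchanged, followed by v_{x+δ} for (n−2)K < x < (n−1)K, form a copy of C^k_{n−1}
-- whose first n−2 edges are edges of the red cycle.  Since there is no red C^k_{n−1}, its last edge
-- {v_{(n−2)K}, v_{(n−2)K+δ+s} (0 < s < K), v_β} is blue; rotating the red cycle, so is every
-- {v_{gK}, v_{gK+δ+s} (0 < s < K), v_{(g+2)K+β}}.  For odd n the sets with β = δ = 0 at
-- g = 0, 2, 4, … (mod n) form a blue C^k_n.  For even n the sets at even g with (β, δ) = (1, 1)
-- and (2, K) alternate to form one.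

open import Defs
open import Data.Bool.Properties using (¬-not)
open import Data.Fin using (Fin; toℕ; fromℕ<; fromℕ; inject₁) renaming (zero to fzero; suc to fsuc)
open import Data.Fin.Properties using (toℕ-fromℕ<; toℕ-injective; toℕ<n; toℕ-fromℕ; toℕ-inject₁)
open import Data.Fin.Subset using (Subset; ⁅_⁆; _∈_; _⊆_)
open import Data.Fin.Subset.Properties using (x∈p∪q⁺; x∈p∪q⁻; ∉⊥; ⊆-antisym)
open import Data.Nat
open import Data.Nat.Divisibility using (divides)
open import Data.Nat.DivMod
open import Data.Nat.Properties
open import Data.Nat.Tactic.RingSolver using (solve-∀)
open import Data.Product using (∃; _×_; _,_; proj₁)
open import Data.Sum using (_⊎_; inj₁; inj₂)
open import Function using (_∘_; id)
open import Function.Definitions using (Injective)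
open import Relation.Binary.PropositionalEquality
open import Relation.Binary.Definitions using (tri<; tri≈; tri>)
open import Relation.Nullary using (¬_; yes; no; contradiction)

⋃⁺ : ∀ {f k} (G : Fin k → Subset f) (t : Fin k) {x} → x ∈ G t → x ∈ ⋃ G
⋃⁺ {k = suc k} G fzero    x∈ = x∈p∪q⁺ (inj₁ x∈)
⋃⁺ {k = suc k} G (fsuc t) x∈ = x∈p∪q⁺ (inj₂ (⋃⁺ (G ∘ fsuc) t x∈))

⋃⁻ : ∀ {f k} (G : Fin k → Subset f) {x} → x ∈ ⋃ G → ∃ λ t → x ∈ G t
⋃⁻ {k = zero}  G x∈ = contradiction x∈ ∉⊥
⋃⁻ {k = suc k} G x∈ with x∈p∪q⁻ (G fzero) (⋃ (G ∘ fsuc)) x∈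
... | inj₁ x∈G₀ = fzero , x∈G₀
... | inj₂ x∈⋃ with ⋃⁻ (G ∘ fsuc) x∈⋃
...   | t , x∈Gt = fsuc t , x∈Gt

⋃⁅⁆-⊆ : ∀ {f k} (F G : Fin k → Fin f) (π : Fin k → Fin k) →
        (∀ t → F t ≡ G (π t)) → ⋃ (⁅_⁆ ∘ F) ⊆ ⋃ (⁅_⁆ ∘ G)
⋃⁅⁆-⊆ F G π F≡Gπ x∈ with ⋃⁻ (⁅_⁆ ∘ F) x∈
... | t , x∈Ft = ⋃⁺ (⁅_⁆ ∘ G) (π t) (subst (λ v → _ ∈ ⁅ v ⁆) (F≡Gπ t) x∈Ft)

⋃⁅⁆-reindex : ∀ {f k} (F G : Fin k → Fin f) (π ρ : Fin k → Fin k) →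
              (∀ t → F t ≡ G (π t)) → (∀ s → π (ρ s) ≡ s) → ⋃ (⁅_⁆ ∘ F) ≡ ⋃ (⁅_⁆ ∘ G)
⋃⁅⁆-reindex F G π ρ F≡Gπ πρ = ⊆-antisym (⋃⁅⁆-⊆ F G π F≡Gπ)
  (⋃⁅⁆-⊆ G F ρ (λ s → trans (cong G (sym (πρ s))) (sym (F≡Gπ (ρ s)))))

even-or-odd : ∀ m → ∃ λ j → m ≡ j * 2 ⊎ m ≡ suc (j * 2)
even-or-odd zero = 0 , inj₁ refl
even-or-odd (suc m) with even-or-odd m
... | j , inj₁ m≡2j  = j , inj₂ (cong suc m≡2j)
... | j , inj₂ m≡2j+1 = suc j , inj₁ (cong suc m≡2j+1)

toℕ-mod : ∀ m n .{{_ : NonZero n}} → toℕ (m mod n) ≡ m % n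
toℕ-mod m n = toℕ-fromℕ< (m%n<n m n)

toℕ-mod-< : ∀ {m n} .{{_ : NonZero n}} → m < n → toℕ (m mod n) ≡ m
toℕ-mod-< {m} {n} m<n = trans (toℕ-mod m n) (m<n⇒m%n≡m m<n)

[m%d+n]%d≡[m+n]%d : ∀ m n d .{{_ : NonZero d}} → (m % d + n) % d ≡ (m + n) % d
[m%d+n]%d≡[m+n]%d m n d = begin
  (m % d + n) % d         ≡⟨ %-distribˡ-+ (m % d) n d ⟩
  (m % d % d + n % d) % d ≡⟨ cong (λ v → (v + n % d) % d) (m%n%n≡m%n m d) ⟩
  (m % d + n % d) % d     ≡⟨ %-distribˡ-+ m n d ⟨
  (m + n) % d             ∎
  where open ≡-Reasoning

[m%d*n]%d≡[m*n]%d : ∀ m n d .{{_ : NonZero d}} → (m % d * n) % d ≡ (m * n) % d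
[m%d*n]%d≡[m*n]%d m n d = begin
  (m % d * n) % d           ≡⟨ %-distribˡ-* (m % d) n d ⟩
  (m % d % d * (n % d)) % d ≡⟨ cong (λ v → (v * (n % d)) % d) (m%n%n≡m%n m d) ⟩
  (m % d * (n % d)) % d     ≡⟨ %-distribˡ-* m n d ⟨
  (m * n) % d               ∎
  where open ≡-Reasoning

[m+n+[d∸n%d]]%d≡m%d : ∀ m n d .{{_ : NonZero d}} → (m + n + (d ∸ n % d)) % d ≡ m % d
[m+n+[d∸n%d]]%d≡m%d m n d = begin
  (m + n + (d ∸ n % d)) % d                   ≡⟨ cong (λ v → (m + v + (d ∸ n % d)) % d) (m≡m%n+[m/n]*n n d) ⟩
  (m + (n % d + n / d * d) + (d ∸ n % d)) % d ≡⟨ cong (_% d) (rearrange m (n % d) (n / d * d) (d ∸ n % d)) ⟩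
  (m + n / d * d + (n % d + (d ∸ n % d))) % d ≡⟨ cong (λ v → (m + n / d * d + v) % d) (m+[n∸m]≡n (m%n≤n n d)) ⟩
  (m + n / d * d + d) % d                     ≡⟨ [m+n]%n≡m%n (m + n / d * d) d ⟩
  (m + n / d * d) % d                         ≡⟨ [m+kn]%n≡m%n m (n / d) d ⟩
  m % d                                       ∎
  where
  open ≡-Reasoning
  rearrange : ∀ a b c e → a + (b + c) + e ≡ a + c + (b + e)
  rearrange = solve-∀

%-cancelʳ-+ : ∀ m o n d .{{_ : NonZero d}} → (m + n) % d ≡ (o + n) % d → m % d ≡ o % d
%-cancelʳ-+ m o n d eq = begin
  m % d                           ≡⟨ [m+n+[d∸n%d]]%d≡m%d m n d ⟨
  (m + n + (d ∸ n % d)) % d       ≡⟨ [m%d+n]%d≡[m+n]%d (m + n) (d ∸ n % d) d ⟨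
  ((m + n) % d + (d ∸ n % d)) % d ≡⟨ cong (λ v → (v + (d ∸ n % d)) % d) eq ⟩
  ((o + n) % d + (d ∸ n % d)) % d ≡⟨ [m%d+n]%d≡[m+n]%d (o + n) (d ∸ n % d) d ⟩
  (o + n + (d ∸ n % d)) % d       ≡⟨ [m+n+[d∸n%d]]%d≡m%d o n d ⟩
  o % d                           ∎
  where open ≡-Reasoning

[m*n+o]%n≡o : ∀ m {n o} .{{_ : NonZero n}} → o < n → (m * n + o) % n ≡ o
[m*n+o]%n≡o m {n} {o} o<n = begin
  (m * n + o) % n ≡⟨ cong (_% n) (+-comm (m * n) o) ⟩
  (o + m * n) % n ≡⟨ [m+kn]%n≡m%n o m n ⟩
  o % n           ≡⟨ m<n⇒m%n≡m o<n ⟩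
  o               ∎
  where open ≡-Reasoning

[m*n+o]/n≡m : ∀ m {n o} .{{_ : NonZero n}} → o < n → (m * n + o) / n ≡ m
[m*n+o]/n≡m m {n} {o} o<n = begin
  (m * n + o) / n   ≡⟨ +-distrib-/-∣ˡ o (divides m refl) ⟩
  m * n / n + o / n ≡⟨ cong₂ _+_ (m*n/n≡m m n) (m<n⇒m/n≡0 o<n) ⟩
  m + 0             ≡⟨ +-identityʳ m ⟩
  m                 ∎
  where open ≡-Reasoning

[m*n+o]%[p*n]≡[m%p]*n+o : ∀ m {n o} p .{{_ : NonZero p}} .{{_ : NonZero (p * n)}} → o < n →
                          (m * n + o) % (p * n) ≡ m % p * n + o
[m*n+o]%[p*n]≡[m%p]*n+o m {n} p o<n =
  trans ([m*n+o]%[p*n]≡[m*n]%[p*n]+o m p o<n) (cong (_+ _) (sym (m%n*o≡m*o%[n*o] m p n)))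

m*n+o<p*n : ∀ {m n o p} → m < p → o < n → m * n + o < p * n
m*n+o<p*n {m} {n} {o} {p} m<p o<n = begin-strict
  m * n + o <⟨ +-monoʳ-< (m * n) o<n ⟩
  m * n + n ≡⟨ +-comm (m * n) n ⟩
  suc m * n ≤⟨ *-monoˡ-≤ n m<p ⟩
  p * n     ∎
  where open ≤-Reasoning

module Cycles {f} (χ : Colouring f) (K₀ m₀ : ℕ) where
  K = suc K₀
  k = suc K
  m = suc m₀
  N = m * K

  toℕ≤K : (t : Fin k) → toℕ t ≤ K
  toℕ≤K t = m<1+n⇒m≤n (toℕ<n t)

  position : Fin m → Fin k → Fin N
  position i t = (toℕ i * K + toℕ t) mod N

  toℕ-position-< : ∀ i t → toℕ t < K → toℕ (position i t) ≡ toℕ i * K + toℕ t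
  toℕ-position-< i t t<K = toℕ-mod-< (m*n+o<p*n (toℕ<n i) t<K)

  toℕ-position-K : ∀ i t → toℕ t ≡ K → toℕ (position i t) ≡ (toℕ i + 1) % m * K + 0
  toℕ-position-K i t t≡K = begin
    toℕ (position i t)        ≡⟨ toℕ-mod (toℕ i * K + toℕ t) N ⟩
    (toℕ i * K + toℕ t) % N   ≡⟨ cong (λ v → (toℕ i * K + v) % N) t≡K ⟩
    (toℕ i * K + K) % N       ≡⟨ cong (_% N) (next-block (toℕ i) K) ⟩
    ((toℕ i + 1) * K + 0) % N ≡⟨ [m*n+o]%[p*n]≡[m%p]*n+o (toℕ i + 1) m (s≤s z≤n) ⟩
    (toℕ i + 1) % m * K + 0   ∎
    where
    open ≡-Reasoning
    next-block : ∀ i K → i * K + K ≡ (i + 1) * K + 0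
    next-block = solve-∀

  IsMonoCycle : Colour → (Fin N → Fin f) → Set
  IsMonoCycle c φ = Injective _≡_ _≡_ φ × (∀ i → χ (cycleEdge k m φ i) ≡ c)

  rotate : ℕ → Fin N → Fin N
  rotate r v = (toℕ v + r * K) mod N

  toℕ-rotate : ∀ r v → toℕ (rotate r v) ≡ (toℕ v + r * K) % N
  toℕ-rotate r v = toℕ-mod (toℕ v + r * K) N

  rotate-injective : ∀ r → Injective _≡_ _≡_ (rotate r)
  rotate-injective r {v} {w} eq = toℕ-injective (begin
    toℕ v     ≡⟨ m<n⇒m%n≡m (toℕ<n v) ⟨
    toℕ v % N ≡⟨ %-cancelʳ-+ (toℕ v) (toℕ w) (r * K) N
                   (trans (sym (toℕ-rotate r v)) (trans (cong toℕ eq) (toℕ-rotate r w))) ⟩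
    toℕ w % N ≡⟨ m<n⇒m%n≡m (toℕ<n w) ⟩
    toℕ w     ∎)
    where open ≡-Reasoning

  cycleEdge-rotate : ∀ (φ : Fin N → Fin f) r (i : Fin m) →
                     cycleEdge k m (φ ∘ rotate r) i ≡ cycleEdge k m φ ((toℕ i + r) mod m)
  cycleEdge-rotate φ r i =
    ⋃⁅⁆-reindex (φ ∘ rotate r ∘ position i) (φ ∘ position j) id id (cong φ ∘ toℕ-injective ∘ same-position) (λ _ → refl)
    where
    open ≡-Reasoning
    j = (toℕ i + r) mod m
    same-position : ∀ t → toℕ (rotate r (position i t)) ≡ toℕ (position j t)
    same-position t = begin
      toℕ (rotate r (position i t))         ≡⟨ toℕ-rotate r (position i t) ⟩
      (toℕ (position i t) + r * K) % N      ≡⟨ cong (λ v → (v + r * K) % N) (toℕ-mod (toℕ i * K + toℕ t) N) ⟩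
      ((toℕ i * K + toℕ t) % N + r * K) % N ≡⟨ [m%d+n]%d≡[m+n]%d (toℕ i * K + toℕ t) (r * K) N ⟩
      (toℕ i * K + toℕ t + r * K) % N       ≡⟨ cong (_% N) (regroup (toℕ i) r (toℕ t) K) ⟩
      ((toℕ i + r) * K + toℕ t) % N         ≡⟨ [m%d+n]%d≡[m+n]%d ((toℕ i + r) * K) (toℕ t) N ⟨
      ((toℕ i + r) * K % N + toℕ t) % N     ≡⟨ cong (λ v → (v + toℕ t) % N) (m%n*o≡m*o%[n*o] (toℕ i + r) m K) ⟨
      ((toℕ i + r) % m * K + toℕ t) % N     ≡⟨ cong (λ v → (v * K + toℕ t) % N) (toℕ-mod (toℕ i + r) m) ⟨
      (toℕ j * K + toℕ t) % N               ≡⟨ toℕ-mod (toℕ j * K + toℕ t) N ⟨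
      toℕ (position j t)                    ∎
      where
      regroup : ∀ a b c d → a * d + c + b * d ≡ (a + b) * d + c
      regroup = solve-∀

  IsMonoCycle-rotate : ∀ {c φ} → IsMonoCycle c φ → ∀ r → IsMonoCycle c (φ ∘ rotate r)
  IsMonoCycle-rotate {c} {φ} (φ-injective , φ-mono) r =
    rotate-injective r ∘ φ-injective ,
    λ i → trans (cong χ (cycleEdge-rotate φ r i)) (φ-mono ((toℕ i + r) mod m))

transpose₀ : ℕ → ℕ → ℕ
transpose₀ β x with x ≟ 0 | x ≟ β
... | yes _ | _     = β
... | no _  | yes _ = 0
... | no _  | no _  = x

transpose₀-fixed : ∀ β x → x ≢ 0 → x ≢ β → transpose₀ β x ≡ x
transpose₀-fixed β x x≢0 x≢β with x ≟ 0 | x ≟ β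
... | yes x≡0 | _     = contradiction x≡0 x≢0
... | no _    | yes x≡β = contradiction x≡β x≢β
... | no _    | no _  = refl

transpose₀-involutive : ∀ β x → transpose₀ β (transpose₀ β x) ≡ x
transpose₀-involutive β x with x ≟ 0 | x ≟ β
transpose₀-involutive β x | yes x≡0 | _ with β ≟ 0 | β ≟ β
... | yes β≡0 | _      = trans β≡0 (sym x≡0)
... | no _    | yes _  = sym x≡0
... | no _    | no β≢β = contradiction refl β≢β
transpose₀-involutive β x | no _ | yes x≡β = sym x≡β
transpose₀-involutive β x | no x≢0 | no x≢β = transpose₀-fixed β x x≢0 x≢β

transpose₀-≤ : ∀ {β x b} → β ≤ b → x ≤ b → transpose₀ β x ≤ b
transpose₀-≤ {β} {x} β≤b x≤b with x ≟ 0 | x ≟ β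
... | yes _ | _     = β≤b
... | no _  | yes _ = z≤n
... | no _  | no _  = x≤b

-- The copy of C^k_{n−1} described above, as a map from its positions to those of an n-cycle.
module Shortcut {f} (χ : Colouring f) (K₀ c₀ : ℕ) (1≤c₀ : 1 ≤ c₀)
                (β δ : ℕ) (β<K : β < suc K₀) (δ≤K : δ ≤ suc K₀) where
  open Cycles χ K₀ (suc c₀) using (K; k; N; toℕ≤K; position; IsMonoCycle; rotate; toℕ-rotate; IsMonoCycle-rotate)
  module C′ = Cycles χ K₀ c₀

  n = suc (suc c₀)
  M = suc c₀ * K
  L = c₀ * K

  K≤L : K ≤ L
  K≤L = subst (_≤ L) (*-identityˡ K) (*-monoˡ-≤ K 1≤c₀)

  L<M : L < M
  L<M = *-monoˡ-< K (n<1+n c₀)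

  β<L : β < L
  β<L = <-≤-trans β<K K≤L

  L<N : L < N
  L<N = <-≤-trans L<M (m≤n+m M K)

  shortcutℕ : ℕ → ℕ
  shortcutℕ x with x ≤? L
  ... | yes _ = transpose₀ β x
  ... | no _  = x + δ

  unshortcutℕ : ℕ → ℕ
  unshortcutℕ y with y ≤? L
  ... | yes _ = transpose₀ β y
  ... | no _  = y ∸ δ

  shortcut-≤ : ∀ {x} → x ≤ L → shortcutℕ x ≡ transpose₀ β x
  shortcut-≤ {x} x≤L with x ≤? L
  ... | yes _   = refl
  ... | no x≰L = contradiction x≤L x≰L

  shortcut-> : ∀ {x} → L < x → shortcutℕ x ≡ x + δ
  shortcut-> {x} L<x with x ≤? L
  ... | yes x≤L = contradiction x≤L (<⇒≱ L<x)
  ... | no _    = refl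

  unshortcut-shortcut : ∀ x → unshortcutℕ (shortcutℕ x) ≡ x
  unshortcut-shortcut x with x ≤? L
  ... | yes x≤L with transpose₀ β x ≤? L
  ...   | yes _  = transpose₀-involutive β x
  ...   | no ≰L = contradiction (transpose₀-≤ (<⇒≤ β<L) x≤L) ≰L
  unshortcut-shortcut x | no x≰L with x + δ ≤? L
  ...   | yes ≤L = contradiction (≤-trans (m≤m+n x δ) ≤L) x≰L
  ...   | no _   = m+n∸n≡m x δ

  shortcut<N : ∀ {x} → x < M → shortcutℕ x < N
  shortcut<N {x} x<M with x ≤? L
  ... | yes x≤L = ≤-<-trans (transpose₀-≤ (<⇒≤ β<L) x≤L) (<-trans L<M (m<n+m M (s≤s z≤n)))
  ... | no _    = subst (x + δ <_) (+-comm M K) (+-mono-<-≤ x<M δ≤K)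

  shortcut : Fin M → Fin N
  shortcut x = fromℕ< (shortcut<N (toℕ<n x))

  toℕ-shortcut : ∀ x → toℕ (shortcut x) ≡ shortcutℕ (toℕ x)
  toℕ-shortcut x = toℕ-fromℕ< (shortcut<N (toℕ<n x))

  shortcut-injective : Injective _≡_ _≡_ shortcut
  shortcut-injective {x} {y} eq = toℕ-injective (begin
    toℕ x                           ≡⟨ unshortcut-shortcut (toℕ x) ⟨
    unshortcutℕ (shortcutℕ (toℕ x)) ≡⟨ cong unshortcutℕ (trans (sym (toℕ-shortcut x)) (trans (cong toℕ eq) (toℕ-shortcut y))) ⟩
    unshortcutℕ (shortcutℕ (toℕ y)) ≡⟨ unshortcut-shortcut (toℕ y) ⟩
    toℕ y                            ∎)
    where open ≡-Reasoning

  path-position≤L : ∀ (i : Fin (suc c₀)) → toℕ i < c₀ → ∀ {s} → s ≤ K → toℕ i * K + s ≤ L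
  path-position≤L i i<c₀ {s} s≤K = begin
    toℕ i * K + s   ≤⟨ +-monoʳ-≤ (toℕ i * K) s≤K ⟩
    toℕ i * K + K   ≡⟨ +-comm (toℕ i * K) K ⟩
    suc (toℕ i) * K ≤⟨ *-monoˡ-≤ K i<c₀ ⟩
    L               ∎
    where open ≤-Reasoning

  toℕ-shortcut-path : ∀ (i : Fin (suc c₀)) → toℕ i < c₀ → ∀ s → s ≤ K →
                      toℕ (shortcut ((toℕ i * K + s) mod M)) ≡ transpose₀ β (toℕ i * K + s)
  toℕ-shortcut-path i i<c₀ s s≤K =
    trans (toℕ-shortcut ((toℕ i * K + s) mod M)) (trans (cong shortcutℕ (toℕ-mod-< (≤-<-trans p≤L L<M))) (shortcut-≤ p≤L))
    where p≤L = path-position≤L i i<c₀ s≤K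

  transposeFin : Fin k → Fin k
  transposeFin t = fromℕ< (s≤s (transpose₀-≤ (<⇒≤ β<K) (toℕ≤K t)))

  toℕ-transposeFin : ∀ t → toℕ (transposeFin t) ≡ transpose₀ β (toℕ t)
  toℕ-transposeFin t = toℕ-fromℕ< _

  transposeFin-involutive : ∀ t → transposeFin (transposeFin t) ≡ t
  transposeFin-involutive t = toℕ-injective (begin
    toℕ (transposeFin (transposeFin t)) ≡⟨ toℕ-transposeFin (transposeFin t) ⟩
    transpose₀ β (toℕ (transposeFin t)) ≡⟨ cong (transpose₀ β) (toℕ-transposeFin t) ⟩
    transpose₀ β (transpose₀ β (toℕ t)) ≡⟨ transpose₀-involutive β (toℕ t) ⟩
    toℕ t ∎)
    where open ≡-Reasoning

  toℕ-shortcut-first : ∀ (i : Fin (suc c₀)) → toℕ i < c₀ → toℕ i ≡ 0 →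
                       ∀ t → toℕ (shortcut (C′.position i t)) ≡ toℕ (position (inject₁ i) (transposeFin t))
  toℕ-shortcut-first i i<c₀ i≡0 t = begin
    toℕ (shortcut (C′.position i t))           ≡⟨ toℕ-shortcut-path i i<c₀ (toℕ t) (toℕ≤K t) ⟩
    transpose₀ β (toℕ i * K + toℕ t)           ≡⟨ cong (λ v → transpose₀ β (v * K + toℕ t)) i≡0 ⟩
    transpose₀ β (toℕ t)                       ≡⟨ toℕ-transposeFin t ⟨
    toℕ (transposeFin t)                       ≡⟨ toℕ-mod-< (≤-<-trans (≤-trans (toℕ≤K (transposeFin t)) K≤L) L<N) ⟨
    toℕ ((0 * K + toℕ (transposeFin t)) mod N) ≡⟨ cong (λ v → toℕ ((v * K + toℕ (transposeFin t)) mod N))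
                                                        (trans (toℕ-inject₁ i) i≡0) ⟨
    toℕ (position (inject₁ i) (transposeFin t)) ∎
    where open ≡-Reasoning

  toℕ-shortcut-later : ∀ (i : Fin (suc c₀)) → toℕ i < c₀ → toℕ i ≢ 0 →
                       ∀ t → toℕ (shortcut (C′.position i t)) ≡ toℕ (position (inject₁ i) t)
  toℕ-shortcut-later i i<c₀ i≢0 t = begin
    toℕ (shortcut (C′.position i t)) ≡⟨ toℕ-shortcut-path i i<c₀ (toℕ t) (toℕ≤K t) ⟩
    transpose₀ β p                   ≡⟨ transpose₀-fixed β p (λ p≡0 → <⇒≢ (<-≤-trans (s≤s z≤n) K≤p) (sym p≡0))
                                                              (λ p≡β → <⇒≢ (<-≤-trans β<K K≤p) (sym p≡β)) ⟩
    p                               ≡⟨ toℕ-mod-< (≤-<-trans (path-position≤L i i<c₀ (toℕ≤K t)) L<N) ⟨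
    toℕ ((toℕ i * K + toℕ t) mod N) ≡⟨ cong (λ v → toℕ ((v * K + toℕ t) mod N)) (toℕ-inject₁ i) ⟨
    toℕ (position (inject₁ i) t)    ∎
    where
    open ≡-Reasoning
    p = toℕ i * K + toℕ t
    K≤p : K ≤ p
    K≤p = ≤-trans (subst (_≤ toℕ i * K) (*-identityˡ K) (*-monoˡ-≤ K (n≢0⇒n>0 i≢0))) (m≤m+n (toℕ i * K) (toℕ t))

  -- Edge 0 contains positions 0 and β, so transposing them does not change it; later edges avoid both.
  shortcut-edge : ∀ (ψ : Fin N → Fin f) (i : Fin (suc c₀)) → toℕ i < c₀ →
                  cycleEdge k (suc c₀) (ψ ∘ shortcut) i ≡ cycleEdge k n ψ (inject₁ i)
  shortcut-edge ψ i i<c₀ with toℕ i ≟ 0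
  ... | yes i≡0 = ⋃⁅⁆-reindex (ψ ∘ shortcut ∘ C′.position i) (ψ ∘ position (inject₁ i)) transposeFin transposeFin
                    (cong ψ ∘ toℕ-injective ∘ toℕ-shortcut-first i i<c₀ i≡0) transposeFin-involutive
  ... | no i≢0  = ⋃⁅⁆-reindex (ψ ∘ shortcut ∘ C′.position i) (ψ ∘ position (inject₁ i)) id id
                    (cong ψ ∘ toℕ-injective ∘ toℕ-shortcut-later i i<c₀ i≢0) (λ _ → refl)

  last-edge-blue : ∀ {ψ} → IsMonoCycle red ψ → ¬ HasMonoCycle k (suc c₀) χ red →
                   χ (cycleEdge k (suc c₀) (ψ ∘ shortcut) (fromℕ c₀)) ≡ blue
  last-edge-blue {ψ} (ψ-injective , ψ-red) no-red = ¬-not λ last-red →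
    no-red (ψ ∘ shortcut , shortcut-injective ∘ ψ-injective , all-red last-red)
    where
    all-red : χ (cycleEdge k (suc c₀) (ψ ∘ shortcut) (fromℕ c₀)) ≡ red →
              ∀ i → χ (cycleEdge k (suc c₀) (ψ ∘ shortcut) i) ≡ red
    all-red last-red i with toℕ i <? c₀
    ... | yes i<c₀ = trans (cong χ (shortcut-edge ψ i i<c₀)) (ψ-red (inject₁ i))
    ... | no i≮c₀ = subst (λ j → χ (cycleEdge k (suc c₀) (ψ ∘ shortcut) j) ≡ red) (sym i≡last) last-red
      where
      i≡last : i ≡ fromℕ c₀
      i≡last = toℕ-injective (trans (≤-antisym (m<1+n⇒m≤n (toℕ<n i)) (≮⇒≥ i≮c₀)) (sym (toℕ-fromℕ c₀)))

  -- The blue edge at block g is {v_{gK + blueOffset s} | s ≤ K}.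
  blueOffset : ℕ → ℕ
  blueOffset zero = 0
  blueOffset (suc s) with suc s <? K
  ... | yes _ = suc s + δ
  ... | no _  = K + K + β

  blueOffset-inner : ∀ {s} → 0 < s → s < K → blueOffset s ≡ s + δ
  blueOffset-inner {suc s} _ s<K with suc s <? K
  ... | yes _  = refl
  ... | no s≮K = contradiction s<K s≮K

  blueOffset-end : blueOffset K ≡ K + K + β
  blueOffset-end with K <? K
  ... | yes K<K = contradiction K<K (<-irrefl refl)
  ... | no _    = refl

  toℕ-shortcut-last : ∀ s → s < K → toℕ (shortcut ((L + s) mod M)) ≡ L + blueOffset s
  toℕ-shortcut-last s s<K = begin
    toℕ (shortcut ((L + s) mod M))  ≡⟨ toℕ-shortcut ((L + s) mod M) ⟩
    shortcutℕ (toℕ ((L + s) mod M)) ≡⟨ cong shortcutℕ (toℕ-mod-< (<-≤-trans (+-monoʳ-< L s<K) (≤-reflexive (+-comm L K)))) ⟩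
    shortcutℕ (L + s)               ≡⟨ shifted s s<K ⟩
    L + blueOffset s                ∎
    where
    open ≡-Reasoning
    shifted : ∀ s → s < K → shortcutℕ (L + s) ≡ L + blueOffset s
    shifted zero _ = trans (shortcut-≤ (≤-reflexive (+-identityʳ L)))
                         (transpose₀-fixed β (L + 0) (λ L+0≡0 → <⇒≢ (≤-<-trans z≤n β<L) (trans (sym L+0≡0) (+-identityʳ L)))
                                                     (λ L+0≡β → <⇒≢ β<L (trans (sym L+0≡β) (+-identityʳ L))))
    shifted (suc s) s<K = trans (shortcut-> (m<m+n L (s≤s z≤n)))
                            (trans (+-assoc L (suc s) δ) (cong (L +_) (sym (blueOffset-inner (s≤s z≤n) s<K))))

  toℕ-shortcut-wrap : toℕ (shortcut ((L + K) mod M)) ≡ β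
  toℕ-shortcut-wrap = begin
    toℕ (shortcut ((L + K) mod M))  ≡⟨ toℕ-shortcut ((L + K) mod M) ⟩
    shortcutℕ (toℕ ((L + K) mod M)) ≡⟨ cong shortcutℕ (trans (toℕ-mod (L + K) M) (trans (cong (_% M) (+-comm L K)) (n%n≡0 M))) ⟩
    shortcutℕ 0                     ≡⟨ shortcut-≤ z≤n ⟩
    β                               ∎
    where open ≡-Reasoning

  rotated-last-vertex : ∀ g s → s ≤ K →
    (toℕ (shortcut ((L + s) mod M)) + (2 + g) * K) % N ≡ (g * K + blueOffset s) % N
  rotated-last-vertex g s s≤K with m≤n⇒m<n∨m≡n s≤K
  ... | inj₁ s<K = begin
    (toℕ (shortcut ((L + s) mod M)) + (2 + g) * K) % N ≡⟨ cong (λ v → (v + (2 + g) * K) % N) (toℕ-shortcut-last s s<K) ⟩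
    (L + blueOffset s + (2 + g) * K) % N               ≡⟨ cong (_% N) (regroup c₀ g (blueOffset s) K) ⟩
    (g * K + blueOffset s + 1 * N) % N                 ≡⟨ [m+kn]%n≡m%n (g * K + blueOffset s) 1 N ⟩
    (g * K + blueOffset s) % N                         ∎
    where
    open ≡-Reasoning
    regroup : ∀ c g o K → c * K + o + (2 + g) * K ≡ g * K + o + 1 * ((2 + c) * K)
    regroup = solve-∀
  ... | inj₂ refl = begin
    (toℕ (shortcut ((L + K) mod M)) + (2 + g) * K) % N ≡⟨ cong (λ v → (v + (2 + g) * K) % N) toℕ-shortcut-wrap ⟩
    (β + (2 + g) * K) % N                              ≡⟨ cong (_% N) (regroup g β K) ⟩
    (g * K + (K + K + β)) % N                          ≡⟨ cong (λ v → (g * K + v) % N) blueOffset-end ⟨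
    (g * K + blueOffset K) % N                         ∎
    where
    open ≡-Reasoning
    regroup : ∀ g b K → b + (2 + g) * K ≡ g * K + (K + K + b)
    regroup = solve-∀

  blue-edge : ∀ {φ} → IsMonoCycle red φ → ¬ HasMonoCycle k (suc c₀) χ red →
              ∀ g (e : Fin k → Fin N) (π ρ : Fin k → Fin k) → (∀ s → π (ρ s) ≡ s) →
              (∀ t → toℕ (e t) ≡ (g * K + blueOffset (toℕ (π t))) % N) →
              χ (⋃ (⁅_⁆ ∘ φ ∘ e)) ≡ blue
  blue-edge {φ} φ-red no-red g e π ρ πρ toℕ-e =
    trans (cong χ (⋃⁅⁆-reindex (φ ∘ e) (ψ ∘ shortcut ∘ C′.position (fromℕ c₀)) π ρ
                                (λ t → cong φ (toℕ-injective (same-position t))) πρ))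
          (last-edge-blue (IsMonoCycle-rotate φ-red (2 + g)) no-red)
    where
    ψ = φ ∘ rotate (2 + g)
    same-position : ∀ t → toℕ (e t) ≡ toℕ (rotate (2 + g) (shortcut (C′.position (fromℕ c₀) (π t))))
    same-position t = begin
      toℕ (e t)                            ≡⟨ toℕ-e t ⟩
      (g * K + blueOffset (toℕ (π t))) % N ≡⟨ rotated-last-vertex g (toℕ (π t)) (toℕ≤K (π t)) ⟨
      (toℕ (shortcut ((L + toℕ (π t)) mod M)) + (2 + g) * K) % N
        ≡⟨ cong (λ v → (toℕ (shortcut ((v * K + toℕ (π t)) mod M)) + (2 + g) * K) % N) (toℕ-fromℕ c₀) ⟨
      (toℕ (shortcut (C′.position (fromℕ c₀) (π t))) + (2 + g) * K) % N
        ≡⟨ toℕ-rotate (2 + g) (shortcut (C′.position (fromℕ c₀) (π t))) ⟨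
      toℕ (rotate (2 + g) (shortcut (C′.position (fromℕ c₀) (π t)))) ∎
      where open ≡-Reasoning

module Relabel {N} (p B : ℕ) .{{_ : NonZero B}} (p*B≡N : p * B ≡ N)
               (G : ℕ → ℕ → ℕ) (G<N : ∀ {j u} → j < p → u < B → G j u < N) where

  relabel : Fin N → Fin N
  relabel x = fromℕ< (G<N (m<n*o⇒m/o<n x<p*B) (m%n<n (toℕ x) B))
    where
    x<p*B : toℕ x < p * B
    x<p*B = subst (toℕ x <_) (sym p*B≡N) (toℕ<n x)

  toℕ-relabel : ∀ x j u → toℕ x ≡ j * B + u → u < B → toℕ (relabel x) ≡ G j u
  toℕ-relabel x j u x≡jB+u u<B = trans (toℕ-fromℕ< _)
    (cong₂ G (trans (cong (_/ B) x≡jB+u) ([m*n+o]/n≡m j u<B))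
             (trans (cong (_% B) x≡jB+u) ([m*n+o]%n≡o j u<B)))

  relabel-injective : (G⁻¹ : ℕ → ℕ) → (∀ {j u} → j < p → u < B → G⁻¹ (G j u) ≡ j * B + u) →
                      Injective _≡_ _≡_ relabel
  relabel-injective G⁻¹ G⁻¹∘G {x} {y} eq = toℕ-injective (begin
    toℕ x                           ≡⟨ decode x ⟨
    G⁻¹ (G (toℕ x / B) (toℕ x % B)) ≡⟨ cong G⁻¹ (trans (sym (toℕ-relabel x _ _ (digits x) (m%n<n (toℕ x) B)))
                                                     (trans (cong toℕ eq) (toℕ-relabel y _ _ (digits y) (m%n<n (toℕ y) B)))) ⟩
    G⁻¹ (G (toℕ y / B) (toℕ y % B)) ≡⟨ decode y ⟩
    toℕ y                           ∎)
    where
    open ≡-Reasoning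
    digits : ∀ z → toℕ z ≡ toℕ z / B * B + toℕ z % B
    digits z = trans (m≡m%n+[m/n]*n (toℕ z) B) (+-comm (toℕ z % B) (toℕ z / B * B))
    decode : ∀ z → G⁻¹ (G (toℕ z / B) (toℕ z % B)) ≡ toℕ z
    decode z = trans (G⁻¹∘G (m<n*o⇒m/o<n (subst (toℕ z <_) (sym p*B≡N) (toℕ<n z))) (m%n<n (toℕ z) B))
                     (sym (digits z))

module OddCycle {f} (χ : Colouring f) (K₀ c₀ : ℕ) (1≤c₀ : 1 ≤ c₀)
                (q : ℕ) (n≡2q+1 : suc (suc c₀) ≡ suc (q * 2)) where
  open Cycles χ K₀ (suc c₀)
  open Shortcut χ K₀ c₀ 1≤c₀ 0 0 (s≤s z≤n) z≤n using (blueOffset; blueOffset-inner; blueOffset-end; blue-edge)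

  n = suc (suc c₀)

  double : ℕ → ℕ
  double j = j * 2 % n

  -- suc q is the inverse of 2 modulo n = 2q + 1.
  halve : ℕ → ℕ
  halve v = v * suc q % n

  halve-double : ∀ {j} → j < n → halve (double j) ≡ j
  halve-double {j} j<n = begin
    j * 2 % n * suc q % n ≡⟨ [m%d*n]%d≡[m*n]%d (j * 2) (suc q) n ⟩
    j * 2 * suc q % n     ≡⟨ cong (_% n) (trans (regroup j q) (cong (λ v → j + j * v) (sym n≡2q+1))) ⟩
    (j + j * n) % n       ≡⟨ [m+kn]%n≡m%n j j n ⟩
    j % n                 ≡⟨ m<n⇒m%n≡m j<n ⟩
    j                     ∎
    where
    open ≡-Reasoning
    regroup : ∀ j q → j * 2 * suc q ≡ j + j * suc (q * 2)
    regroup = solve-∀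

  double-next : ∀ i → double ((i + 1) % n) ≡ (double i + 2) % n
  double-next i = begin
    (i + 1) % n * 2 % n ≡⟨ [m%d*n]%d≡[m*n]%d (i + 1) 2 n ⟩
    (i + 1) * 2 % n     ≡⟨ cong (_% n) (regroup i) ⟩
    (i * 2 + 2) % n     ≡⟨ [m%d+n]%d≡[m+n]%d (i * 2) 2 n ⟨
    (double i + 2) % n  ∎
    where
    open ≡-Reasoning
    regroup : ∀ i → (i + 1) * 2 ≡ i * 2 + 2
    regroup = solve-∀

  blueVertex : ℕ → ℕ → ℕ
  blueVertex j u = double j * K + u

  blueVertex<N : ∀ {j u} → j < n → u < K → blueVertex j u < N
  blueVertex<N {j} _ u<K = m*n+o<p*n (m%n<n (j * 2) n) u<K

  blueVertex⁻¹ : ℕ → ℕ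
  blueVertex⁻¹ y = halve (y / K) * K + y % K

  blueVertex⁻¹∘blueVertex : ∀ {j u} → j < n → u < K → blueVertex⁻¹ (blueVertex j u) ≡ j * K + u
  blueVertex⁻¹∘blueVertex {j} j<n u<K = cong₂ (λ a b → a * K + b)
    (trans (cong halve ([m*n+o]/n≡m (double j) u<K)) (halve-double j<n))
    ([m*n+o]%n≡o (double j) u<K)

  open Relabel n K refl blueVertex blueVertex<N

  blue-edges : ∀ {φ} → IsMonoCycle red φ → ¬ HasMonoCycle k (suc c₀) χ red →
               ∀ i → χ (cycleEdge k n (φ ∘ relabel) i) ≡ blue
  blue-edges φ-red no-red i = blue-edge φ-red no-red (double (toℕ i)) (relabel ∘ position i) id id (λ _ → refl) vertex
    where
    open ≡-Reasoning
    vertex : ∀ t → toℕ (relabel (position i t)) ≡ (double (toℕ i) * K + blueOffset (toℕ t)) % N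
    vertex t with m≤n⇒m<n∨m≡n (toℕ≤K t)
    ... | inj₁ t<K = begin
      toℕ (relabel (position i t))                  ≡⟨ toℕ-relabel (position i t) (toℕ i) (toℕ t) (toℕ-position-< i t t<K) t<K ⟩
      double (toℕ i) * K + toℕ t                    ≡⟨ m<n⇒m%n≡m (blueVertex<N (toℕ<n i) t<K) ⟨
      (double (toℕ i) * K + toℕ t) % N              ≡⟨ cong (λ v → (double (toℕ i) * K + v) % N) (blueOffset-< (toℕ t) t<K) ⟨
      (double (toℕ i) * K + blueOffset (toℕ t)) % N ∎
      where
      blueOffset-< : ∀ s → s < K → blueOffset s ≡ s
      blueOffset-< zero    _   = refl
      blueOffset-< (suc s) s<K = trans (blueOffset-inner (s≤s z≤n) s<K) (+-identityʳ (suc s))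
    ... | inj₂ t≡K = begin
      toℕ (relabel (position i t))                  ≡⟨ toℕ-relabel (position i t) ((toℕ i + 1) % n) 0 (toℕ-position-K i t t≡K) (s≤s z≤n) ⟩
      double ((toℕ i + 1) % n) * K + 0              ≡⟨ cong (λ v → v * K + 0) (double-next (toℕ i)) ⟩
      (double (toℕ i) + 2) % n * K + 0              ≡⟨ [m*n+o]%[p*n]≡[m%p]*n+o (double (toℕ i) + 2) n (s≤s z≤n) ⟨
      ((double (toℕ i) + 2) * K + 0) % N            ≡⟨ cong (_% N) (regroup (double (toℕ i)) K) ⟩
      (double (toℕ i) * K + (K + K + 0)) % N        ≡⟨ cong (λ v → (double (toℕ i) * K + v) % N) (trans (cong blueOffset t≡K) blueOffset-end) ⟨
      (double (toℕ i) * K + blueOffset (toℕ t)) % N ∎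
      where
      regroup : ∀ g K → (g + 2) * K + 0 ≡ g * K + (K + K + 0)
      regroup = solve-∀

  blue-cycle : ∀ {φ} → IsMonoCycle red φ → ¬ HasMonoCycle k (suc c₀) χ red → HasMonoCycle k n χ blue
  blue-cycle {φ} φ-red no-red =
    φ ∘ relabel , relabel-injective blueVertex⁻¹ blueVertex⁻¹∘blueVertex ∘ proj₁ φ-red , blue-edges φ-red no-red

module EvenCycle {f} (χ : Colouring f) (K₀ c₀ : ℕ) (1≤c₀ : 1 ≤ c₀) (2≤K₀ : 2 ≤ K₀)
                 (q₀ : ℕ) (n≡2q : suc (suc c₀) ≡ suc q₀ * 2) where
  open Cycles χ K₀ (suc c₀)

  -- Blocks 2j and 2j+1 form pair j, at positions jB, …, jB + B − 1; blueVertex j u is the position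
  -- on the red cycle of position jB + u on the blue one.
  n = suc (suc c₀)
  q = suc q₀
  B = K + K

  1<K : 1 < K
  1<K = s≤s (≤-trans (s≤s z≤n) 2≤K₀)

  K<B : K < B
  K<B = m<m+n K (s≤s z≤n)

  module Shortcut₂ⱼ = Shortcut χ K₀ c₀ 1≤c₀ 1 1 1<K (s≤s z≤n)
  module Shortcut₂ⱼ₊₁ = Shortcut χ K₀ c₀ 1≤c₀ 2 K (s≤s 2≤K₀) ≤-refl

  q*B≡N : q * B ≡ N
  q*B≡N = trans (regroup q K) (cong (_* K) (sym n≡2q))
    where
    regroup : ∀ q K → q * (K + K) ≡ q * 2 * K
    regroup = solve-∀

  pair<N : ∀ {j u} → j < q → u < B → j * B + u < N
  pair<N {j} {u} j<q u<B = subst (j * B + u <_) q*B≡N (m*n+o<p*n j<q u<B)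

  within-pair : ∀ j {o} → j < q → o < B → (j * 2 * K + o) % N ≡ j * B + o
  within-pair j {o} j<q o<B = trans (cong (λ v → (v + o) % N) (regroup j K)) (m<n⇒m%n≡m (pair<N j<q o<B))
    where
    regroup : ∀ j K → j * 2 * K ≡ j * (K + K)
    regroup = solve-∀

  next-pair : ∀ j {o} → o < B → (j * 2 * K + (K + K + o)) % N ≡ suc j % q * B + o
  next-pair j {o} o<B = begin
    (j * 2 * K + (K + K + o)) % N ≡⟨ cong (_% N) (regroup j K o) ⟩
    (suc j * B + o) % N           ≡⟨ %-congʳ {o = suc j * B + o} (sym q*B≡N) ⟩
    (suc j * B + o) % (q * B)     ≡⟨ [m*n+o]%[p*n]≡[m%p]*n+o (suc j) q o<B ⟩
    suc j % q * B + o             ∎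
    where
    open ≡-Reasoning
    regroup : ∀ j K o → j * 2 * K + (K + K + o) ≡ suc j * (K + K) + o
    regroup = solve-∀

  blueVertex : ℕ → ℕ → ℕ
  blueVertex j u with u <? K₀ | u ≟ K₀ | u ≟ K
  ... | yes _ | _     | _     = j * B + (2 + u)
  ... | no _  | yes _ | _     = suc j % q * B + 1
  ... | no _  | no _  | yes _ = j * B
  ... | no _  | no _  | no _  = j * B + u

  blueVertex-shifted : ∀ j {u} → u < K₀ → blueVertex j u ≡ j * B + (2 + u)
  blueVertex-shifted j {u} u<K₀ with u <? K₀
  ... | yes _    = refl
  ... | no u≮K₀ = contradiction u<K₀ u≮K₀

  blueVertex-last : ∀ j → blueVertex j K₀ ≡ suc j % q * B + 1
  blueVertex-last j with K₀ <? K₀ | K₀ ≟ K₀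
  ... | yes K₀<K₀ | _        = contradiction K₀<K₀ (<-irrefl refl)
  ... | no _      | yes _    = refl
  ... | no _      | no K₀≢K₀ = contradiction refl K₀≢K₀

  blueVertex-middle : ∀ j → blueVertex j K ≡ j * B
  blueVertex-middle j with K <? K₀ | K ≟ K₀ | K ≟ K
  ... | yes K<K₀ | _       | _     = contradiction (<-trans K<K₀ (n<1+n K₀)) (<-irrefl refl)
  ... | no _     | yes K≡K₀ | _    = contradiction (sym K≡K₀) (<⇒≢ (n<1+n K₀))
  ... | no _     | no _    | yes _ = refl
  ... | no _     | no _    | no K≢K = contradiction refl K≢K

  blueVertex-unchanged : ∀ j {u} → K < u → blueVertex j u ≡ j * B + u
  blueVertex-unchanged j {u} K<u with u <? K₀ | u ≟ K₀ | u ≟ K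
  ... | yes u<K₀ | _       | _       = contradiction (<-trans u<K₀ (<-trans (n<1+n K₀) K<u)) (<-irrefl refl)
  ... | no _     | yes u≡K₀ | _      = contradiction (<-trans (n<1+n K₀) K<u) (<-irrefl (sym u≡K₀))
  ... | no _     | no _    | yes u≡K = contradiction K<u (<-irrefl (sym u≡K))
  ... | no _     | no _    | no _    = refl

  blueVertex<N : ∀ {j u} → j < q → u < B → blueVertex j u < N
  blueVertex<N {j} {u} j<q u<B with u <? K₀ | u ≟ K₀ | u ≟ K
  ... | yes u<K₀ | _     | _     = pair<N j<q (≤-<-trans (s≤s u<K₀) K<B)
  ... | no _     | yes _ | _     = pair<N (m%n<n (suc j) q) (<-trans 1<K K<B)
  ... | no _     | no _  | yes _ = subst (_< N) (+-identityʳ (j * B)) (pair<N j<q (s≤s z≤n))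
  ... | no _     | no _  | no _  = pair<N j<q u<B

  placeOf : ℕ → ℕ → ℕ
  placeOf j zero          = j * B + K
  placeOf j (suc zero)    = (j + q₀) % q * B + K₀
  placeOf j (suc (suc v)) with suc (suc v) ≤? K
  ... | yes _ = j * B + v
  ... | no _  = j * B + suc (suc v)

  placeOf-shifted : ∀ j {u} → u < K₀ → placeOf j (2 + u) ≡ j * B + u
  placeOf-shifted j {u} u<K₀ with 2 + u ≤? K
  ... | yes _    = refl
  ... | no 2+u≰K = contradiction (s≤s u<K₀) 2+u≰K

  placeOf-unchanged : ∀ j {u} → K < u → placeOf j u ≡ j * B + u
  placeOf-unchanged j {suc zero}    (s≤s ())
  placeOf-unchanged j {suc (suc v)} K<u with suc (suc v) ≤? K
  ... | yes u≤K = contradiction u≤K (<⇒≱ K<u)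
  ... | no _    = refl

  previous-next : ∀ {j} → j < q → (suc j % q + q₀) % q ≡ j
  previous-next {j} j<q = begin
    (suc j % q + q₀) % q ≡⟨ [m%d+n]%d≡[m+n]%d (suc j) q₀ q ⟩
    (suc j + q₀) % q     ≡⟨ cong (_% q) (+-suc j q₀) ⟨
    (j + q) % q          ≡⟨ [m+n]%n≡m%n j q ⟩
    j % q                ≡⟨ m<n⇒m%n≡m j<q ⟩
    j                    ∎
    where open ≡-Reasoning

  blueVertex⁻¹ : ℕ → ℕ
  blueVertex⁻¹ y = placeOf (y / B) (y % B)

  blueVertex⁻¹-digits : ∀ j {u} → u < B → blueVertex⁻¹ (j * B + u) ≡ placeOf j u
  blueVertex⁻¹-digits j u<B = cong₂ placeOf ([m*n+o]/n≡m j u<B) ([m*n+o]%n≡o j u<B)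

  blueVertex⁻¹∘blueVertex : ∀ {j u} → j < q → u < B → blueVertex⁻¹ (blueVertex j u) ≡ j * B + u
  blueVertex⁻¹∘blueVertex {j} {u} j<q u<B with u <? K₀ | u ≟ K₀ | u ≟ K
  ... | yes u<K₀ | _        | _       = trans (blueVertex⁻¹-digits j (≤-<-trans (s≤s u<K₀) K<B)) (placeOf-shifted j u<K₀)
  ... | no _     | yes refl | _       = trans (blueVertex⁻¹-digits (suc j % q) (<-trans 1<K K<B))
                                              (cong (λ v → v * B + K₀) (previous-next j<q))
  ... | no _     | no _     | yes refl = trans (cong blueVertex⁻¹ (sym (+-identityʳ (j * B)))) (blueVertex⁻¹-digits j (s≤s z≤n))
  ... | no u≮K₀ | no u≢K₀  | no u≢K  = trans (blueVertex⁻¹-digits j u<B) (placeOf-unchanged j K<u)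
    where
    K<u : K < u
    K<u = ≤∧≢⇒< (≤∧≢⇒< (≮⇒≥ u≮K₀) (u≢K₀ ∘ sym)) (u≢K ∘ sym)

  open Relabel q B q*B≡N blueVertex blueVertex<N

  half<q : ∀ (i : Fin n) {j} → toℕ i ≡ j * 2 ⊎ toℕ i ≡ suc (j * 2) → j < q
  half<q i {j} i≡ = *-cancelʳ-< 2 j q (subst (j * 2 <_) n≡2q (≤-<-trans (2j≤i i≡) (toℕ<n i)))
    where
    2j≤i : toℕ i ≡ j * 2 ⊎ toℕ i ≡ suc (j * 2) → j * 2 ≤ toℕ i
    2j≤i (inj₁ i≡2j)   = ≤-reflexive (sym i≡2j)
    2j≤i (inj₂ i≡2j+1) = ≤-trans (n≤1+n (j * 2)) (≤-reflexive (sym i≡2j+1))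

  shift unshift : Fin k → Fin k
  shift t   = (toℕ t + 1) mod k
  unshift s = (toℕ s + K) mod k

  shift-unshift : ∀ s → shift (unshift s) ≡ s
  shift-unshift s = toℕ-injective (begin
    toℕ (shift (unshift s))   ≡⟨ toℕ-mod (toℕ (unshift s) + 1) k ⟩
    (toℕ (unshift s) + 1) % k ≡⟨ cong (λ v → (v + 1) % k) (toℕ-mod (toℕ s + K) k) ⟩
    ((toℕ s + K) % k + 1) % k ≡⟨ [m%d+n]%d≡[m+n]%d (toℕ s + K) 1 k ⟩
    (toℕ s + K + 1) % k       ≡⟨ cong (_% k) (trans (+-assoc (toℕ s) K 1) (cong (toℕ s +_) (+-comm K 1))) ⟩
    (toℕ s + k) % k           ≡⟨ [m+n]%n≡m%n (toℕ s) k ⟩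
    toℕ s % k                 ≡⟨ m<n⇒m%n≡m (toℕ<n s) ⟩
    toℕ s                     ∎)
    where open ≡-Reasoning

  toℕ-shift-< : ∀ {t} → toℕ t < K → toℕ (shift t) ≡ suc (toℕ t)
  toℕ-shift-< {t} t<K = trans (toℕ-mod-< (subst (toℕ t + 1 <_) (+-comm K 1) (+-monoˡ-< 1 t<K))) (+-comm (toℕ t) 1)

  toℕ-shift-K : ∀ {t} → toℕ t ≡ K → toℕ (shift t) ≡ 0
  toℕ-shift-K {t} t≡K = trans (toℕ-mod (toℕ t + 1) k) (trans (cong (λ v → (v + 1) % k) t≡K)
                                                          (trans (cong (_% k) (+-comm K 1)) (n%n≡0 k)))

  -- Edge 2j runs through pair j as 2jK+2, …, 2jK+K, (2j+2)K+1, 2jK: the blue edge of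
  -- Shortcut with β = δ = 1 at block 2j, listed from its second vertex on.
  module Edge₂ⱼ (i : Fin n) {j} (i≡2j : toℕ i ≡ j * 2) where
    open Shortcut₂ⱼ using (blueOffset; blueOffset-inner; blueOffset-end; blue-edge)
    open ≡-Reasoning

    j<q : j < q
    j<q = half<q i {j} (inj₁ i≡2j)

    toℕ-relabel-position : ∀ t → toℕ (relabel (position i t)) ≡ blueVertex j (toℕ t)
    toℕ-relabel-position t = toℕ-relabel (position i t) j (toℕ t)
      (trans (toℕ-mod (toℕ i * K + toℕ t) N) (trans (cong (λ v → (v * K + toℕ t) % N) i≡2j) (within-pair j j<q t<B)))
      t<B
      where
      t<B : toℕ t < B
      t<B = <-≤-trans (toℕ<n t) K<B

    vertex-shifted : ∀ t → toℕ t < K₀ → toℕ (relabel (position i t)) ≡ (j * 2 * K + blueOffset (toℕ (shift t))) % N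
    vertex-shifted t t<K₀ = begin
      toℕ (relabel (position i t))                 ≡⟨ toℕ-relabel-position t ⟩
      blueVertex j (toℕ t)                         ≡⟨ blueVertex-shifted j t<K₀ ⟩
      j * B + (2 + toℕ t)                          ≡⟨ within-pair j j<q (≤-<-trans (s≤s t<K₀) K<B) ⟨
      (j * 2 * K + (2 + toℕ t)) % N                ≡⟨ cong (λ v → (j * 2 * K + v) % N) offset ⟨
      (j * 2 * K + blueOffset (toℕ (shift t))) % N ∎
      where
      offset : blueOffset (toℕ (shift t)) ≡ 2 + toℕ t
      offset = trans (cong blueOffset (toℕ-shift-< (≤-trans t<K₀ (n≤1+n K₀))))
                     (trans (blueOffset-inner (s≤s z≤n) (s≤s t<K₀)) (+-comm (suc (toℕ t)) 1))

    vertex-last : ∀ t → toℕ t ≡ K₀ → toℕ (relabel (position i t)) ≡ (j * 2 * K + blueOffset (toℕ (shift t))) % N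
    vertex-last t t≡K₀ = begin
      toℕ (relabel (position i t))                 ≡⟨ toℕ-relabel-position t ⟩
      blueVertex j (toℕ t)                         ≡⟨ cong (blueVertex j) t≡K₀ ⟩
      blueVertex j K₀                              ≡⟨ blueVertex-last j ⟩
      suc j % q * B + 1                            ≡⟨ next-pair j (<-trans 1<K K<B) ⟨
      (j * 2 * K + (K + K + 1)) % N                ≡⟨ cong (λ v → (j * 2 * K + v) % N) offset ⟨
      (j * 2 * K + blueOffset (toℕ (shift t))) % N ∎
      where
      offset : blueOffset (toℕ (shift t)) ≡ K + K + 1
      offset = trans (cong blueOffset (trans (toℕ-shift-< (≤-reflexive (cong suc t≡K₀))) (cong suc t≡K₀))) blueOffset-end

    vertex-middle : ∀ t → toℕ t ≡ K → toℕ (relabel (position i t)) ≡ (j * 2 * K + blueOffset (toℕ (shift t))) % N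
    vertex-middle t t≡K = begin
      toℕ (relabel (position i t))                 ≡⟨ toℕ-relabel-position t ⟩
      blueVertex j (toℕ t)                         ≡⟨ cong (blueVertex j) t≡K ⟩
      blueVertex j K                               ≡⟨ blueVertex-middle j ⟩
      j * B                                        ≡⟨ +-identityʳ (j * B) ⟨
      j * B + 0                                    ≡⟨ within-pair j j<q (s≤s z≤n) ⟨
      (j * 2 * K + 0) % N                          ≡⟨ cong (λ v → (j * 2 * K + blueOffset v) % N) (toℕ-shift-K t≡K) ⟨
      (j * 2 * K + blueOffset (toℕ (shift t))) % N ∎

    edge-blue : ∀ {φ} → IsMonoCycle red φ → ¬ HasMonoCycle k (suc c₀) χ red →
                χ (cycleEdge k n (φ ∘ relabel) i) ≡ blue
    edge-blue φ-red no-red = blue-edge φ-red no-red (j * 2) (relabel ∘ position i) shift unshift shift-unshift vertex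
      where
      vertex : ∀ t → toℕ (relabel (position i t)) ≡ (j * 2 * K + blueOffset (toℕ (shift t))) % N
      vertex t with <-cmp (toℕ t) K₀
      ... | tri< t<K₀ _ _ = vertex-shifted t t<K₀
      ... | tri≈ _ t≡K₀ _ = vertex-last t t≡K₀
      ... | tri> _ _ K₀<t = vertex-middle t (≤-antisym (toℕ≤K t) K₀<t)

  -- Edge 2j+1 runs 2jK, 2jK+K+1, …, 2jK+2K−1, (2j+2)K+2: the blue edge of Shortcut
  -- with β = 2, δ = K at block 2j, in order.
  module Edge₂ⱼ₊₁ (i : Fin n) {j} (i≡2j+1 : toℕ i ≡ suc (j * 2)) where
    open Shortcut₂ⱼ₊₁ using (blueOffset; blueOffset-inner; blueOffset-end; blue-edge)
    open ≡-Reasoning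

    j<q : j < q
    j<q = half<q i {j} (inj₂ i≡2j+1)

    position-regroup : ∀ s → toℕ i * K + s ≡ j * 2 * K + (K + s)
    position-regroup s = trans (cong (λ v → v * K + s) i≡2j+1) (regroup j K s)
      where
      regroup : ∀ j K s → suc (j * 2) * K + s ≡ j * 2 * K + (K + s)
      regroup = solve-∀

    vertex-inner : ∀ t → toℕ t < K → toℕ (relabel (position i t)) ≡ (j * 2 * K + blueOffset (toℕ t)) % N
    vertex-inner t t<K = trans (toℕ-relabel (position i t) j (K + toℕ t) position≡ (+-monoʳ-< K t<K)) (inner (toℕ t) t<K)
      where
      position≡ : toℕ (position i t) ≡ j * B + (K + toℕ t)
      position≡ = trans (toℕ-mod (toℕ i * K + toℕ t) N)
                        (trans (cong (_% N) (position-regroup (toℕ t))) (within-pair j j<q (+-monoʳ-< K t<K)))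
      inner : ∀ s → s < K → blueVertex j (K + s) ≡ (j * 2 * K + blueOffset s) % N
      inner zero _ = begin
        blueVertex j (K + 0) ≡⟨ cong (blueVertex j) (+-identityʳ K) ⟩
        blueVertex j K       ≡⟨ blueVertex-middle j ⟩
        j * B                ≡⟨ +-identityʳ (j * B) ⟨
        j * B + 0            ≡⟨ within-pair j j<q (s≤s z≤n) ⟨
        (j * 2 * K + 0) % N  ∎
      inner (suc s) s<K = begin
        blueVertex j (K + suc s)             ≡⟨ blueVertex-unchanged j (m<m+n K (s≤s z≤n)) ⟩
        j * B + (K + suc s)                  ≡⟨ within-pair j j<q (+-monoʳ-< K s<K) ⟨
        (j * 2 * K + (K + suc s)) % N        ≡⟨ cong (λ v → (j * 2 * K + v) % N) (+-comm K (suc s)) ⟩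
        (j * 2 * K + (suc s + K)) % N        ≡⟨ cong (λ v → (j * 2 * K + v) % N) (blueOffset-inner (s≤s z≤n) s<K) ⟨
        (j * 2 * K + blueOffset (suc s)) % N ∎

    vertex-end : ∀ t → toℕ t ≡ K → toℕ (relabel (position i t)) ≡ (j * 2 * K + blueOffset (toℕ t)) % N
    vertex-end t t≡K = begin
      toℕ (relabel (position i t))         ≡⟨ toℕ-relabel (position i t) (suc j % q) 0 position≡ (s≤s z≤n) ⟩
      blueVertex (suc j % q) 0             ≡⟨ blueVertex-shifted (suc j % q) (≤-trans (s≤s z≤n) 2≤K₀) ⟩
      suc j % q * B + 2                    ≡⟨ next-pair j (<-trans (s≤s 2≤K₀) K<B) ⟨
      (j * 2 * K + (K + K + 2)) % N        ≡⟨ cong (λ v → (j * 2 * K + v) % N) (trans (cong blueOffset t≡K) blueOffset-end) ⟨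
      (j * 2 * K + blueOffset (toℕ t)) % N ∎
      where
      position≡ : toℕ (position i t) ≡ suc j % q * B + 0
      position≡ = begin
        toℕ (position i t)            ≡⟨ toℕ-mod (toℕ i * K + toℕ t) N ⟩
        (toℕ i * K + toℕ t) % N       ≡⟨ cong (λ v → (toℕ i * K + v) % N) t≡K ⟩
        (toℕ i * K + K) % N           ≡⟨ cong (_% N) (position-regroup K) ⟩
        (j * 2 * K + (K + K)) % N     ≡⟨ cong (λ v → (j * 2 * K + v) % N) (+-identityʳ (K + K)) ⟨
        (j * 2 * K + (K + K + 0)) % N ≡⟨ next-pair j (s≤s z≤n) ⟩
        suc j % q * B + 0             ∎

    edge-blue : ∀ {φ} → IsMonoCycle red φ → ¬ HasMonoCycle k (suc c₀) χ red →
                χ (cycleEdge k n (φ ∘ relabel) i) ≡ blue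
    edge-blue φ-red no-red = blue-edge φ-red no-red (j * 2) (relabel ∘ position i) id id (λ _ → refl) vertex
      where
      vertex : ∀ t → toℕ (relabel (position i t)) ≡ (j * 2 * K + blueOffset (toℕ t)) % N
      vertex t with m≤n⇒m<n∨m≡n (toℕ≤K t)
      ... | inj₁ t<K = vertex-inner t t<K
      ... | inj₂ t≡K = vertex-end t t≡K

  blue-cycle : ∀ {φ} → IsMonoCycle red φ → ¬ HasMonoCycle k (suc c₀) χ red → HasMonoCycle k n χ blue
  blue-cycle {φ} φ-red no-red =
    φ ∘ relabel , relabel-injective blueVertex⁻¹ blueVertex⁻¹∘blueVertex ∘ proj₁ φ-red , edge-blue
    where
    edge-blue : ∀ i → χ (cycleEdge k n (φ ∘ relabel) i) ≡ blue
    edge-blue i with even-or-odd (toℕ i)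
    ... | j , inj₁ i≡2j   = Edge₂ⱼ.edge-blue i {j} i≡2j φ-red no-red
    ... | j , inj₂ i≡2j+1 = Edge₂ⱼ₊₁.edge-blue i {j} i≡2j+1 φ-red no-red

lemma1 : (n k f : ℕ) → 3 ≤ n → 6 ≤ k → (k ∸ 1) * n ≤ f →
         .{{_ : NonZero (n * (k ∸ 1))}} → .{{_ : NonZero ((n ∸ 1) * (k ∸ 1))}} →
         (χ : Colouring f) →
         HasMonoCycle k n χ red → ¬ HasMonoCycle k (n ∸ 1) χ red →
         HasMonoCycle k n χ blue
-- The bound on f is implied by the red copy of C^k_n, and k ≥ 4 would suffice.
lemma1 (suc (suc (suc c₀))) (suc (suc K₀)) f (s≤s (s≤s (s≤s _))) (s≤s (s≤s 4≤K₀)) _ χ (φ , φ-red) no-red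
  with even-or-odd (3 + c₀)
... | zero , inj₁ ()
... | q , inj₂ n≡2q+1 = OddCycle.blue-cycle χ K₀ (suc c₀) (s≤s z≤n) q n≡2q+1 φ-red no-red
... | suc q₀ , inj₁ n≡2q =
  EvenCycle.blue-cycle χ K₀ (suc c₀) (s≤s z≤n) (≤-trans (s≤s (s≤s z≤n)) 4≤K₀) q₀ n≡2q φ-red no-red
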